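{- Let $k$ and $N>1$ be integers. Suppose that the complete graph $K_N$ is factorable into spanning subgraphs $H_1,H_2,\ldots,H_k$, where for each $i\in[k]$, $H_i\cong r_iK_{q_i+1}\cup(n_i-r_i)K_{q_i}$ (the disjoint union of $r_i$ copies of $K_{q_i+1}$ and $n_i-r_i$ copies of $K_{q_i}$) for some non-negative integers $n_i,q_i,r_i$ satisfying $N=n_iq_i+r_i$ and $0\le r_i<n_i$. Assume further that $(n_i-r_i-1)q_i>0$ for some $i\in[k]$. Then $$\bar{R}(n_1+1,n_2+1,\ldots,n_k+1)=N+1.$$
   Context: For a positive integer $n$, $[n]=\{1,\dots,n\}$. For positive integers $n,k$, an edge-coloring of $K_n$ with $k$ colors is a map $f:\binom{[n]}{2}\to[k]$. For $i\in[k]$, $f^{ -1}(i)$ denotes the graph on vertex set $[n]$ whose edges are the pairs of color $i$, and $\alpha_i(f)$ denotes the independence number of this graph. For positive integers $m_1,\dots,m_k$, the complementary Ramsey number $\bar{R}(m_1,\dots,m_k)$ is the least positive integer $n$ such that for every edge-coloring $f$ of $K_n$ with $k$ colors there exists $i\in[k]$ with $\alpha_i(f)\ge m_i$. A graph $G$ is factorable into spanning subgraphs $H_1,\dots,H_k$ if these are spanning subgraphs of $G$ whose edge sets partition the edge set of $G$. -}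

module Defs where

open import Data.Nat using (ℕ; zero; suc; _+_; _*_; _≤_; _<_)
open import Data.Fin using (Fin; splitAt; _≟_)
open import Data.Fin.Subset using (Subset; _∈_; ∣_∣)
open import Data.Bool using (Bool; true; false; not; _∧_)
open import Data.Sum using (_⊎_; inj₁; inj₂)
open import Data.Product using (Σ; _×_; _,_)
open import Data.Empty using (⊥-elim)
open import Relation.Nullary using (does; yes; no)
open import Relation.Binary.PropositionalEquality using (_≡_; refl; sym)
open import Function.Bundles using (_⤖_; Bijection)

record Graph (n : ℕ) : Set where
  field
    adj    : Fin n → Fin n → Bool
    adjSym : ∀ x y → adj x y ≡ adj y x
    adjIrr : ∀ x → adj x x ≡ false
open Graph public

private
  not-cong : ∀ {a b} → a ≡ b → not a ≡ not b
  not-cong refl = refl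

  ≟-sym : ∀ {n} (x y : Fin n) → does (x ≟ y) ≡ does (y ≟ x)
  ≟-sym x y with x ≟ y | y ≟ x
  ... | yes _ | yes _ = refl
  ... | no _  | no _  = refl
  ... | yes p | no q  = ⊥-elim (q (sym p))
  ... | no p  | yes q = ⊥-elim (p (sym q))

  ≟-refl : ∀ {n} (x : Fin n) → not (does (x ≟ x)) ≡ false
  ≟-refl x with x ≟ x
  ... | yes _ = refl
  ... | no p  = ⊥-elim (p refl)

K : (m : ℕ) → Graph m
K m = record
  { adj    = λ x y → not (does (x ≟ y))
  ; adjSym = λ x y → not-cong (≟-sym x y)
  ; adjIrr = ≟-refl
  }

emptyGraph : Graph 0
emptyGraph = record { adj = λ () ; adjSym = λ () ; adjIrr = λ () }

private
  adj⊎ : ∀ {a b} → Graph a → Graph b → Fin a ⊎ Fin b → Fin a ⊎ Fin b → Bool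
  adj⊎ G H (inj₁ x) (inj₁ y) = adj G x y
  adj⊎ G H (inj₂ x) (inj₂ y) = adj H x y
  adj⊎ G H (inj₁ _) (inj₂ _) = false
  adj⊎ G H (inj₂ _) (inj₁ _) = false

  adj⊎-sym : ∀ {a b} (G : Graph a) (H : Graph b) u v → adj⊎ G H u v ≡ adj⊎ G H v u
  adj⊎-sym G H (inj₁ x) (inj₁ y) = adjSym G x y
  adj⊎-sym G H (inj₂ x) (inj₂ y) = adjSym H x y
  adj⊎-sym G H (inj₁ _) (inj₂ _) = refl
  adj⊎-sym G H (inj₂ _) (inj₁ _) = refl

  adj⊎-irr : ∀ {a b} (G : Graph a) (H : Graph b) u → adj⊎ G H u u ≡ false
  adj⊎-irr G H (inj₁ x) = adjIrr G x
  adj⊎-irr G H (inj₂ x) = adjIrr H x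

_∪G_ : ∀ {a b} → Graph a → Graph b → Graph (a + b)
_∪G_ {a} G H = record
  { adj    = λ x y → adj⊎ G H (splitAt a x) (splitAt a y)
  ; adjSym = λ x y → adj⊎-sym G H (splitAt a x) (splitAt a y)
  ; adjIrr = λ x → adj⊎-irr G H (splitAt a x)
  }

copies : ∀ {m} (c : ℕ) → Graph m → Graph (c * m)
copies zero    G = emptyGraph
copies (suc c) G = G ∪G copies c G

_≅_ : ∀ {a b} → Graph a → Graph b → Set
_≅_ {a} {b} G H = Σ (Fin a ⤖ Fin b) λ φ →
  ∀ x y → adj G x y ≡ adj H (Bijection.to φ x) (Bijection.to φ y)

FactorableInto : ∀ {n k} → Graph n → (Fin k → Graph n) → Set
FactorableInto {n} {k} G H =
  (∀ i x y → adj (H i) x y ≡ true → adj G x y ≡ true) ×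
  (∀ x y → adj G x y ≡ true →
     Σ (Fin k) λ i → adj (H i) x y ≡ true × (∀ j → adj (H j) x y ≡ true → j ≡ i))

-- An edge-colouring of K_n with k colours: a colour for every pair {x,y},
-- represented as a symmetric function (diagonal values are irrelevant).
record EdgeColoring (n k : ℕ) : Set where
  field
    col    : Fin n → Fin n → Fin k
    colSym : ∀ x y → col x y ≡ col y x
open EdgeColoring public

private
  colAdj : ∀ {n k} → EdgeColoring n k → Fin k → Fin n → Fin n → Bool
  colAdj f i x y = not (does (x ≟ y)) ∧ does (col f x y ≟ i)

  ∧-cong : ∀ {a b c d} → a ≡ b → c ≡ d → (a ∧ c) ≡ (b ∧ d)
  ∧-cong refl refl = refl

  ≟-cong : ∀ {k} {a b : Fin k} (i : Fin k) → a ≡ b → does (a ≟ i) ≡ does (b ≟ i)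
  ≟-cong i refl = refl

  irr∧ : ∀ {n} (x : Fin n) b → (not (does (x ≟ x)) ∧ b) ≡ false
  irr∧ x b with x ≟ x
  ... | yes _ = refl
  ... | no p  = ⊥-elim (p refl)

colorClass : ∀ {n k} → EdgeColoring n k → Fin k → Graph n
colorClass f i = record
  { adj    = colAdj f i
  ; adjSym = λ x y → ∧-cong (not-cong (≟-sym x y)) (≟-cong i (colSym f x y))
  ; adjIrr = λ x → irr∧ x _
  }

Independent : ∀ {n} → Graph n → Subset n → Set
Independent G S = ∀ x y → x ∈ S → y ∈ S → adj G x y ≡ false

IndepNumberAtLeast : ∀ {n} → Graph n → ℕ → Set
IndepNumberAtLeast {n} G m = Σ (Subset n) λ S → Independent G S × m ≤ ∣ S ∣

ComplRamseyProp : (k : ℕ) → (Fin k → ℕ) → ℕ → Set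
ComplRamseyProp k m n = ∀ (f : EdgeColoring n k) →
  Σ (Fin k) λ i → IndepNumberAtLeast (colorClass f i) (m i)

ComplRamseyIs : (k : ℕ) → (Fin k → ℕ) → ℕ → Set
ComplRamseyIs k m R =
  (0 < R) × ComplRamseyProp k m R ×
  (∀ n → 0 < n → ComplRamseyProp k m n → R ≤ n)

-- Lower bound: colour an edge of K_N by the unique H_i containing it.  Each H_i is a disjoint
-- union of n_i cliques, so an independent set of colour i meets each clique at most once and
-- α_i ≤ n_i; the same holds for every restriction to n′ ≤ N vertices.
--
-- Upper bound: suppose a colouring of K_{N+1} has α_i ≤ n_i for every colour.  A Turán-type
-- bound then gives colour class i a degree sum of at least 2q_i(N+1) − n_i q_i(q_i+1), which
-- is the degree sum of H_i plus 2q_i.  As both families partition the edges of complete graphs,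
-- summing over i yields Σ q_i ≤ N.  On the other hand, the degree sums of the H_i give
-- Σ (n_i − r_i) q_i = N Σ q_i − N(N − 1), and the hypothesis (n_j − r_j − 1) q_j > 0 makes the
-- left side exceed Σ q_i, which forces Σ q_i > N.

module Submission where

open import Defs
open import Data.Bool using (Bool; true; false; not; _∧_; _∨_; if_then_else_)
open import Data.Empty using (⊥; ⊥-elim)
open import Data.Fin using (Fin; zero; suc; _≟_; _↑ˡ_; _↑ʳ_; splitAt; join; inject≤)
open import Data.Fin.Subset using (Subset; _∈_; ∣_∣)
open import Data.Vec using ([]; _∷_; lookup; tabulate)
open import Data.Vec.Properties using (lookup∘tabulate; []=⇒lookup; lookup⇒[]=)
open import Data.Fin.Properties
  using (suc-injective; splitAt-↑ˡ; splitAt-↑ʳ; splitAt-join; splitAt⁻¹-↑ˡ; splitAt⁻¹-↑ʳ; ↑ˡ-injective; ↑ʳ-injective; inject≤-injective)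
open import Data.Nat using (ℕ; zero; suc; _+_; _*_; _∸_; _≤_; _<_; z≤n; s≤s; z<s; _≤?_)
open import Data.Nat.Tactic.RingSolver using (solve-∀)
open import Data.Nat.Properties hiding (_≟_; suc-injective)
open import Data.Product using (Σ; ∃; _×_; _,_; proj₁; proj₂)
open import Data.Sum as Sum using (_⊎_; inj₁; inj₂)
open import Function using (_∘_)
open import Function.Bundles using (Bijection)
open import Function.Properties.Bijection using (⤖⇒↔)
open import Relation.Binary.PropositionalEquality
open import Relation.Nullary using (¬_; does; yes; no; contradiction)
open import Relation.Nullary.Decidable using (dec-true; dec-false)

open import Algebra.Properties.Semiring.Sum +-*-semiring
  using (sum; sum-cong-≗; ∑-distrib-+; ∑-comm; ∑-permute; *-distribˡ-sum; *-distribʳ-sum)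

-- Counting over Fin

𝟙 : Bool → ℕ
𝟙 true  = 1
𝟙 false = 0

count : ∀ {m} → (Fin m → Bool) → ℕ
count P = sum (λ x → 𝟙 (P x))

sum-mono-≤ : ∀ {m} {f g : Fin m → ℕ} → (∀ x → f x ≤ g x) → sum f ≤ sum g
sum-mono-≤ {zero}  f≤g = z≤n
sum-mono-≤ {suc m} f≤g = +-mono-≤ (f≤g zero) (sum-mono-≤ (f≤g ∘ suc))

sum-const : ∀ m c → sum {m} (λ _ → c) ≡ m * c
sum-const zero    c = refl
sum-const (suc m) c = cong (c +_) (sum-const m c)

≤-sum : ∀ {m} (f : Fin m → ℕ) i → f i ≤ sum f
≤-sum f zero    = m≤m+n _ _
≤-sum f (suc i) = ≤-trans (≤-sum (f ∘ suc) i) (m≤n+m _ (f zero))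

sum-↑ : ∀ a b (f : Fin (a + b) → ℕ) → sum f ≡ sum (f ∘ (_↑ˡ b)) + sum (f ∘ (a ↑ʳ_))
sum-↑ zero    b f = refl
sum-↑ (suc a) b f = trans (cong (f zero +_) (sum-↑ a b (f ∘ suc))) (sym (+-assoc (f zero) _ _))

count-all : ∀ m → count {m} (λ _ → true) ≡ m
count-all m = trans (sum-const m 1) (*-identityʳ m)

count-none : ∀ {m} {P : Fin m → Bool} → (∀ x → P x ≡ false) → count P ≡ 0
count-none {zero}          none = refl
count-none {suc m} {P} none rewrite none zero = count-none (none ∘ suc)

count-mono : ∀ {m} {P Q : Fin m → Bool} → (∀ x → P x ≡ true → Q x ≡ true) → count P ≤ count Q
count-mono {P = P} {Q} P⊆Q = sum-mono-≤ 𝟙-mono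
  where
  𝟙-mono : ∀ x → 𝟙 (P x) ≤ 𝟙 (Q x)
  𝟙-mono x with P x in Px
  ... | false = z≤n
  ... | true rewrite P⊆Q x Px = ≤-refl

count-≤1 : ∀ {m} {P : Fin m → Bool} → (∀ x y → P x ≡ true → P y ≡ true → x ≡ y) → count P ≤ 1
count-≤1 {zero}          _   = z≤n
count-≤1 {suc m} {P} at-most-one with P zero in P0
... | false = count-≤1 λ x y Px Py → suc-injective (at-most-one (suc x) (suc y) Px Py)
... | true  = ≤-reflexive (cong suc (count-none others))
  where
  others : ∀ x → P (suc x) ≡ false
  others x with P (suc x) in Px
  ... | false = refl
  ... | true with () ← at-most-one zero (suc x) P0 Px

count-unique : ∀ {m} {P : Fin m → Bool} v → P v ≡ true → (∀ x → P x ≡ true → x ≡ v) → count P ≡ 1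
count-unique {P = P} v Pv unique = ≤-antisym
  (count-≤1 λ x y Px Py → trans (unique x Px) (sym (unique y Py)))
  (subst (λ b → 𝟙 b ≤ count P) Pv (≤-sum (𝟙 ∘ P) v))

≟-true : ∀ {m} {x y : Fin m} → does (x ≟ y) ≡ true → x ≡ y
≟-true {x = x} {y} eq with x ≟ y
... | yes x≡y = x≡y

count-≟ : ∀ {m} (v : Fin m) → count (λ x → does (v ≟ x)) ≡ 1
count-≟ v = count-unique v (dec-true (v ≟ v) refl) (λ x eq → sym (≟-true eq))

count-≤-injective : ∀ {m c} {P : Fin m → Bool} (h : Fin m → Fin c) →
  (∀ x y → P x ≡ true → P y ≡ true → h x ≡ h y → x ≡ y) → count P ≤ c
count-≤-injective {c = c} {P} h injective = begin
  count P                                           ≡⟨ sum-cong-≗ by-block ⟩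
  sum (λ x → sum (λ b → 𝟙 (P x ∧ does (h x ≟ b))))  ≡⟨ ∑-comm (λ x b → 𝟙 (P x ∧ does (h x ≟ b))) ⟩
  sum (λ b → count (λ x → P x ∧ does (h x ≟ b)))    ≤⟨ sum-mono-≤ (λ b → count-≤1 (block-≤1 b)) ⟩
  count {c} (λ _ → true)                            ≡⟨ count-all c ⟩
  c                                                 ∎
  where
  open ≤-Reasoning
  by-block : ∀ x → 𝟙 (P x) ≡ count (λ b → P x ∧ does (h x ≟ b))
  by-block x with P x
  ... | false = sym (count-none {c} λ _ → refl)
  ... | true  = sym (count-≟ (h x))
  block-≤1 : ∀ b x y → (P x ∧ does (h x ≟ b)) ≡ true → (P y ∧ does (h y ≟ b)) ≡ true → x ≡ y
  block-≤1 b x y Px Py with P x in Px' | P y in Py' | h x ≟ b | h y ≟ b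
  ... | true | true | yes hx≡b | yes hy≡b = injective x y Px' Py' (trans hx≡b (sym hy≡b))

-- Degree sums

degreeSum : ∀ {m} → Graph m → ℕ
degreeSum G = sum (λ x → count (adj G x))

adj-K : ∀ {m} {x y : Fin m} → x ≢ y → adj (K m) x y ≡ true
adj-K {x = x} {y} x≢y = cong not (dec-false (x ≟ y) x≢y)

count-not : ∀ {m} (P : Fin m → Bool) → count (not ∘ P) + count P ≡ m
count-not {m} P = begin
  count (not ∘ P) + count P           ≡⟨ ∑-distrib-+ (𝟙 ∘ not ∘ P) (𝟙 ∘ P) ⟨
  sum (λ x → 𝟙 (not (P x)) + 𝟙 (P x)) ≡⟨ sum-cong-≗ (λ x → 𝟙-not (P x)) ⟩
  count {m} (λ _ → true)              ≡⟨ count-all m ⟩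
  m                                   ∎
  where
  open ≡-Reasoning
  𝟙-not : ∀ b → 𝟙 (not b) + 𝟙 b ≡ 1
  𝟙-not true  = refl
  𝟙-not false = refl

degreeSum-K : ∀ m → degreeSum (K m) + m ≡ m * m
degreeSum-K m = begin
  degreeSum (K m) + m                        ≡⟨ cong (degreeSum (K m) +_) (count-all m) ⟨
  degreeSum (K m) + count {m} (λ _ → true)   ≡⟨ ∑-distrib-+ (λ x → count (adj (K m) x)) (λ _ → 1) ⟨
  sum (λ x → count (adj (K m) x) + 1)        ≡⟨ sum-cong-≗ (λ x → cong (count (adj (K m) x) +_) (count-≟ x)) ⟨
  sum (λ x → count (adj (K m) x) + count (λ y → does (x ≟ y))) ≡⟨ sum-cong-≗ (λ x → count-not {m} (λ y → does (x ≟ y))) ⟩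
  sum {m} (λ _ → m)                          ≡⟨ sum-const m m ⟩
  m * m                                      ∎
  where open ≡-Reasoning

module _ {a b} (G : Graph a) (H : Graph b) where

  adj-∪G-ˡˡ : ∀ u u' → adj (G ∪G H) (u ↑ˡ b) (u' ↑ˡ b) ≡ adj G u u'
  adj-∪G-ˡˡ u u' rewrite splitAt-↑ˡ a u b | splitAt-↑ˡ a u' b = refl

  adj-∪G-ˡʳ : ∀ u v → adj (G ∪G H) (u ↑ˡ b) (a ↑ʳ v) ≡ false
  adj-∪G-ˡʳ u v rewrite splitAt-↑ˡ a u b | splitAt-↑ʳ a b v = refl

  adj-∪G-ʳˡ : ∀ v u → adj (G ∪G H) (a ↑ʳ v) (u ↑ˡ b) ≡ false
  adj-∪G-ʳˡ v u rewrite splitAt-↑ˡ a u b | splitAt-↑ʳ a b v = refl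

  adj-∪G-ʳʳ : ∀ v v' → adj (G ∪G H) (a ↑ʳ v) (a ↑ʳ v') ≡ adj H v v'
  adj-∪G-ʳʳ v v' rewrite splitAt-↑ʳ a b v | splitAt-↑ʳ a b v' = refl

  degreeSum-∪G : degreeSum (G ∪G H) ≡ degreeSum G + degreeSum H
  degreeSum-∪G = trans (sum-↑ a b _) (cong₂ _+_ (sum-cong-≗ left) (sum-cong-≗ right))
    where
    left : ∀ u → count (adj (G ∪G H) (u ↑ˡ b)) ≡ count (adj G u)
    left u = begin
      count (adj (G ∪G H) (u ↑ˡ b))   ≡⟨ sum-↑ a b _ ⟩
      count (adj (G ∪G H) (u ↑ˡ b) ∘ (_↑ˡ b)) + count (adj (G ∪G H) (u ↑ˡ b) ∘ (a ↑ʳ_))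
        ≡⟨ cong₂ _+_ (sum-cong-≗ (cong 𝟙 ∘ adj-∪G-ˡˡ u)) (count-none (adj-∪G-ˡʳ u)) ⟩
      count (adj G u) + 0             ≡⟨ +-identityʳ _ ⟩
      count (adj G u)                 ∎
      where open ≡-Reasoning
    right : ∀ v → count (adj (G ∪G H) (a ↑ʳ v)) ≡ count (adj H v)
    right v = trans (sum-↑ a b _)
      (cong₂ _+_ (count-none (adj-∪G-ʳˡ v)) (sum-cong-≗ (cong 𝟙 ∘ adj-∪G-ʳʳ v)))

degreeSum-copies : ∀ {m} c (G : Graph m) → degreeSum (copies c G) ≡ c * degreeSum G
degreeSum-copies zero    G = refl
degreeSum-copies (suc c) G = trans (degreeSum-∪G G (copies c G)) (cong (degreeSum G +_) (degreeSum-copies c G))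

degreeSum-≅ : ∀ {a b} {G : Graph a} {H : Graph b} → G ≅ H → degreeSum G ≡ degreeSum H
degreeSum-≅ {G = G} {H} (φ , adj≡) = sym (trans (∑-permute _ π) (sum-cong-≗ row))
  where
  π = ⤖⇒↔ φ
  row : ∀ x → count (adj H (Bijection.to φ x)) ≡ count (adj G x)
  row x = trans (∑-permute _ π) (sum-cong-≗ (λ y → cong 𝟙 (sym (adj≡ x y))))

EdgePartition : ∀ {k m} → (Fin k → Graph m) → Set
EdgePartition {m = m} G = ∀ x y → count (λ i → adj (G i) x y) ≡ 𝟙 (adj (K m) x y)

degreeSum-partition : ∀ {k m} (G : Fin k → Graph m) → EdgePartition G →
  sum (λ i → degreeSum (G i)) + m ≡ m * m
degreeSum-partition {k} {m} G partition = trans (cong (_+ m) regroup) (degreeSum-K m)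
  where
  open ≡-Reasoning
  regroup : sum (λ i → degreeSum (G i)) ≡ degreeSum (K m)
  regroup = begin
    sum (λ i → sum (λ x → count (adj (G i) x)))         ≡⟨ ∑-comm (λ i x → count (adj (G i) x)) ⟩
    sum (λ x → sum (λ i → count (adj (G i) x)))         ≡⟨ sum-cong-≗ (λ x → ∑-comm (λ i y → 𝟙 (adj (G i) x y))) ⟩
    sum (λ x → sum (λ y → count (λ i → adj (G i) x y))) ≡⟨ sum-cong-≗ (λ x → sum-cong-≗ (partition x)) ⟩
    degreeSum (K m)                                     ∎

factorable⇒partition : ∀ {k m} {H : Fin k → Graph m} → FactorableInto (K m) H → EdgePartition H
factorable⇒partition {H = H} (H⊆K , unique) x y with adj (K _) x y in xy
... | true  = let i , Hi , only-i = unique x y xy in count-unique i Hi only-i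
... | false = count-none not-in-H
  where
  not-in-H : ∀ i → adj (H i) x y ≡ false
  not-in-H i with adj (H i) x y in Hi
  ... | false = refl
  ... | true with () ← trans (sym (H⊆K i x y Hi)) xy

colorClass-partition : ∀ {m k} (f : EdgeColoring m k) → EdgePartition (colorClass f)
colorClass-partition {k = k} f x y with x ≟ y
... | yes _ = count-none {k} (λ _ → refl)
... | no  _ = count-unique (col f x y) (dec-true (col f x y ≟ col f x y) refl) (λ i eq → sym (≟-true eq))

-- Clique covers

record CliqueCover {m} (G : Graph m) (c : ℕ) : Set where
  field
    block  : Fin m → Fin c
    clique : ∀ x y → block x ≡ block y → x ≢ y → adj G x y ≡ true
open CliqueCover

cover-K : ∀ m → CliqueCover (K m) 1
cover-K m = record { block = λ _ → zero ; clique = λ _ _ _ → adj-K }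

cover-∪G : ∀ {a b c d} {G : Graph a} {H : Graph b} →
  CliqueCover G c → CliqueCover H d → CliqueCover (G ∪G H) (c + d)
cover-∪G {a} {b} {c} {d} {G} {H} 𝒢 ℋ = record { block = block′ ; clique = clique′ }
  where
  block′ : Fin (a + b) → Fin (c + d)
  block′ x = join c d (Sum.map (block 𝒢) (block ℋ) (splitAt a x))

  inj₁≢inj₂ : ∀ {u v} → join c d (inj₁ u) ≢ join c d (inj₂ v)
  inj₁≢inj₂ {u} {v} eq
    with () ← trans (sym (splitAt-join c d (inj₁ u))) (trans (cong (splitAt c) eq) (splitAt-join c d (inj₂ v)))

  -- block′ is unfolded here so that `with` can abstract over splitAt.
  clique′ : ∀ x y → join c d (Sum.map (block 𝒢) (block ℋ) (splitAt a x))
                  ≡ join c d (Sum.map (block 𝒢) (block ℋ) (splitAt a y)) →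
            x ≢ y → adj (G ∪G H) x y ≡ true
  clique′ x y same x≢y with splitAt a x in ex | splitAt a y in ey
  ... | inj₁ u | inj₁ u' = clique 𝒢 u u' (↑ˡ-injective d _ _ same)
    λ { refl → x≢y (trans (sym (splitAt⁻¹-↑ˡ ex)) (splitAt⁻¹-↑ˡ ey)) }
  ... | inj₂ v | inj₂ v' = clique ℋ v v' (↑ʳ-injective c _ _ same)
    λ { refl → x≢y (trans (sym (splitAt⁻¹-↑ʳ ex)) (splitAt⁻¹-↑ʳ ey)) }
  ... | inj₁ u | inj₂ v' = ⊥-elim (inj₁≢inj₂ same)
  ... | inj₂ v | inj₁ u' = ⊥-elim (inj₁≢inj₂ (sym same))

cover-copies : ∀ {m} {G : Graph m} → CliqueCover G 1 → ∀ c → CliqueCover (copies c G) c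
cover-copies 𝒢 zero    = record { block = λ () ; clique = λ () }
cover-copies 𝒢 (suc c) = cover-∪G 𝒢 (cover-copies 𝒢 c)

cover-pullback : ∀ {a b c} {G : Graph a} {H : Graph b} (φ : Fin a → Fin b) →
  (∀ {x y} → φ x ≡ φ y → x ≡ y) → (∀ x y → adj H (φ x) (φ y) ≡ true → adj G x y ≡ true) →
  CliqueCover H c → CliqueCover G c
cover-pullback φ φ-inj H∘φ⊆G ℋ = record
  { block  = block ℋ ∘ φ
  ; clique = λ x y same x≢y → H∘φ⊆G x y (clique ℋ (φ x) (φ y) same (x≢y ∘ φ-inj))
  }

cover-≅ : ∀ {a b c} {G : Graph a} {H : Graph b} → G ≅ H → CliqueCover H c → CliqueCover G c
cover-≅ (φ , adj≡) = cover-pullback (Bijection.to φ) (Bijection.injective φ) (λ x y → trans (adj≡ x y))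

independent-≤-cover : ∀ {m c} {G : Graph m} {P : Fin m → Bool} → CliqueCover G c →
  (∀ x y → P x ≡ true → P y ≡ true → adj G x y ≡ false) → count P ≤ c
independent-≤-cover {P = P} 𝒢 independent = count-≤-injective (block 𝒢) separated
  where
  separated : ∀ x y → P x ≡ true → P y ≡ true → block 𝒢 x ≡ block 𝒢 y → x ≡ y
  separated x y Px Py same with x ≟ y
  ... | yes x≡y = x≡y
  ... | no  x≢y with () ← trans (sym (clique 𝒢 x y same x≢y)) (independent x y Px Py)

-- A Turán-type bound

∧-true : ∀ {a b} → a ∧ b ≡ true → a ≡ true × b ≡ true
∧-true {true} b≡true = refl , b≡true

minimumOn : ∀ {m} (P : Fin m → Bool) (f : Fin m → ℕ) →
  (∀ x → P x ≡ false) ⊎ ∃ λ v → P v ≡ true × (∀ x → P x ≡ true → f v ≤ f x)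
minimumOn {zero}  P f = inj₁ λ ()
minimumOn {suc m} P f with minimumOn (P ∘ suc) (f ∘ suc) | P zero in P0
... | inj₁ none | false = inj₁ λ { zero → P0 ; (suc x) → none x }
... | inj₁ none | true  =
  inj₂ (zero , P0 , λ { zero _ → ≤-refl ; (suc x) Px → contradiction (trans (sym Px) (none x)) λ () })
... | inj₂ (v , Pv , min) | false =
  inj₂ (suc v , Pv , λ { zero Px → contradiction (trans (sym Px) P0) λ () ; (suc x) → min x })
... | inj₂ (v , Pv , min) | true with f zero ≤? f (suc v)
...   | yes f0≤ = inj₂ (zero , P0 , λ { zero _ → ≤-refl ; (suc x) Px → ≤-trans f0≤ (min x Px) })
...   | no  f0≰ = inj₂ (suc v , Pv , λ { zero _ → <⇒≤ (≰⇒> f0≰) ; (suc x) → min x })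

count-∧-split : ∀ {m} (P Q : Fin m → Bool) →
  count P ≡ count (λ x → P x ∧ not (Q x)) + count (λ x → P x ∧ Q x)
count-∧-split P Q =
  trans (sum-cong-≗ split) (∑-distrib-+ (λ x → 𝟙 (P x ∧ not (Q x))) (λ x → 𝟙 (P x ∧ Q x)))
  where
  split : ∀ x → 𝟙 (P x) ≡ 𝟙 (P x ∧ not (Q x)) + 𝟙 (P x ∧ Q x)
  split x with P x | Q x
  ... | true  | true  = refl
  ... | true  | false = refl
  ... | false | _     = refl

-- The difference of the two sides is (d − q)(d + 1 − q), a product of consecutive integers.
2q[d+1]≤d[d+1]+q[q+1] : ∀ d q → 2 * q * suc d ≤ suc d * d + q * suc q
2q[d+1]≤d[d+1]+q[q+1] d       zero    = z≤n
2q[d+1]≤d[d+1]+q[q+1] zero    (suc q) =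
  subst₂ _≤_ (lhs q) (rhs q) (*-monoʳ-≤ (suc q) (s≤s (s≤s (z≤n {q}))))
  where
  lhs : ∀ q → suc q * 2 ≡ 2 * suc q * 1
  lhs = solve-∀
  rhs : ∀ q → suc q * suc (suc q) ≡ 1 * 0 + suc q * suc (suc q)
  rhs = solve-∀
2q[d+1]≤d[d+1]+q[q+1] (suc d) (suc q) =
  subst₂ _≤_ (lhs d q) (rhs d q) (+-monoʳ-≤ (2 * (d + q + 2)) (2q[d+1]≤d[d+1]+q[q+1] d q))
  where
  lhs : ∀ d q → 2 * (d + q + 2) + 2 * q * suc d ≡ 2 * suc q * suc (suc d)
  lhs = solve-∀
  rhs : ∀ d q → 2 * (d + q + 2) + (suc d * d + q * suc q) ≡ suc (suc d) * suc d + suc q * suc (suc q)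
  rhs = solve-∀

module _ {M} (G : Graph M) where

  degreeIn : (Fin M → Bool) → Fin M → ℕ
  degreeIn P x = count (λ y → P y ∧ adj G x y)

  degreeSumIn : (Fin M → Bool) → ℕ
  degreeSumIn P = sum (λ x → if P x then degreeIn P x else 0)

  IndependentIn : (Fin M → Bool) → (Fin M → Bool) → Set
  IndependentIn P S =
    (∀ x → S x ≡ true → P x ≡ true) × (∀ x y → S x ≡ true → S y ≡ true → adj G x y ≡ false)

  closedNbhd : Fin M → Fin M → Bool
  closedNbhd v x = does (v ≟ x) ∨ adj G v x

  module RemoveClosedNbhd (P : Fin M → Bool) (v : Fin M) (Pv : P v ≡ true) where

    P′ : Fin M → Bool
    P′ x = P x ∧ not (closedNbhd v x)

    count-P∧closedNbhd : count (λ x → P x ∧ closedNbhd v x) ≡ suc (degreeIn P v)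
    count-P∧closedNbhd = begin
      count (λ x → P x ∧ closedNbhd v x)                ≡⟨ sum-cong-≗ split ⟩
      sum (λ x → 𝟙 (does (v ≟ x)) + 𝟙 (P x ∧ adj G v x)) ≡⟨ ∑-distrib-+ (λ x → 𝟙 (does (v ≟ x))) (λ x → 𝟙 (P x ∧ adj G v x)) ⟩
      count (λ x → does (v ≟ x)) + degreeIn P v           ≡⟨ cong (_+ degreeIn P v) (count-≟ v) ⟩
      suc (degreeIn P v)                                  ∎
      where
      open ≡-Reasoning
      split : ∀ x → 𝟙 (P x ∧ closedNbhd v x) ≡ 𝟙 (does (v ≟ x)) + 𝟙 (P x ∧ adj G v x)
      split x with v ≟ x
      ... | yes refl rewrite Pv | adjIrr G v = refl
      ... | no  _    with P x
      ...   | true  = refl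
      ...   | false = refl

    count-P′ : count P ≡ count P′ + suc (degreeIn P v)
    count-P′ = trans (count-∧-split P (closedNbhd v)) (cong (count P′ +_) count-P∧closedNbhd)

    P′-edge⇒P-edge : ∀ x y → (P′ y ∧ adj G x y) ≡ true → (P y ∧ adj G x y) ≡ true
    P′-edge⇒P-edge x y with P y | closedNbhd v y
    ... | true  | false = λ edge → edge

    degreeSumIn-P′ : (∀ x → P x ≡ true → degreeIn P v ≤ degreeIn P x) →
      degreeSumIn P′ + suc (degreeIn P v) * degreeIn P v ≤ degreeSumIn P
    degreeSumIn-P′ min = begin
      degreeSumIn P′ + suc d * d
        ≡⟨ cong (degreeSumIn P′ +_) (trans (sym (*-distribʳ-sum d (λ x → 𝟙 (P x ∧ closedNbhd v x))))
                                           (cong (_* d) count-P∧closedNbhd)) ⟨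
      degreeSumIn P′ + sum (λ x → 𝟙 (P x ∧ closedNbhd v x) * d)
        ≡⟨ ∑-distrib-+ (λ x → if P′ x then degreeIn P′ x else 0) (λ x → 𝟙 (P x ∧ closedNbhd v x) * d) ⟨
      sum (λ x → (if P′ x then degreeIn P′ x else 0) + 𝟙 (P x ∧ closedNbhd v x) * d) ≤⟨ sum-mono-≤ pointwise ⟩
      degreeSumIn P ∎
      where
      open ≤-Reasoning
      d = degreeIn P v
      pointwise : ∀ x → (if P′ x then degreeIn P′ x else 0) + 𝟙 (P x ∧ closedNbhd v x) * d
                        ≤ (if P x then degreeIn P x else 0)
      pointwise x with P x in Px | closedNbhd v x
      ... | true  | true  = ≤-trans (≤-reflexive (+-identityʳ d)) (min x Px)
      ... | true  | false = ≤-trans (≤-reflexive (+-identityʳ _)) (count-mono (P′-edge⇒P-edge x))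
      ... | false | _     = z≤n

    closedNbhd-∉ : ∀ {S} → IndependentIn P′ S → ∀ x → S x ≡ true → v ≢ x × adj G v x ≡ false
    closedNbhd-∉ (S⊆P′ , _) x Sx with P x | v ≟ x | adj G v x | S⊆P′ x Sx
    ... | true  | no v≢x | false | _  = v≢x , refl
    ... | true  | yes _  | _     | ()
    ... | true  | no _   | true  | ()
    ... | false | _      | _     | ()

    extend : ∀ {n} → (∃ λ S → IndependentIn P′ S × n ≤ count S) → ∃ λ S → IndependentIn P S × suc n ≤ count S
    extend (S , S-indep@(S⊆P′ , S-indep′) , n≤S) =
      S′ , (S′⊆P , S′-indep) , ≤-trans (s≤s n≤S) (≤-reflexive (sym count-S′))
      where
      S′ : Fin M → Bool
      S′ x = does (v ≟ x) ∨ S x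

      count-S′ : count S′ ≡ suc (count S)
      count-S′ = trans (sum-cong-≗ split)
        (trans (∑-distrib-+ (λ x → 𝟙 (does (v ≟ x))) (𝟙 ∘ S)) (cong (_+ count S) (count-≟ v)))
        where
        split : ∀ x → 𝟙 (S′ x) ≡ 𝟙 (does (v ≟ x)) + 𝟙 (S x)
        split x with v ≟ x | S x in Sx
        ... | yes refl | true  = contradiction refl (proj₁ (closedNbhd-∉ S-indep v Sx))
        ... | yes refl | false = refl
        ... | no _     | _     = refl

      S′⊆P : ∀ x → S′ x ≡ true → P x ≡ true
      S′⊆P x _ with v ≟ x | S x in Sx
      ... | yes refl | _    = Pv
      ... | no _     | true = proj₁ (∧-true (S⊆P′ x Sx))

      S′-indep : ∀ x y → S′ x ≡ true → S′ y ≡ true → adj G x y ≡ false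
      S′-indep x y _ _ with v ≟ x | S x in Sx | v ≟ y | S y in Sy
      ... | yes refl | _    | yes refl | _    = adjIrr G v
      ... | yes refl | _    | no _     | true = proj₂ (closedNbhd-∉ S-indep y Sy)
      ... | no _     | true | yes refl | _    = trans (adjSym G x v) (proj₂ (closedNbhd-∉ S-indep x Sx))
      ... | no _     | true | no _     | true = S-indep′ x y Sx Sy

  -- Greedy argument: delete the closed neighbourhood of a vertex v of minimum degree d in G[P]
  -- and recurse with n − 1; this removes d + 1 vertices and at least (d + 1) d of the degree sum.
  turán : ∀ (P : Fin M → Bool) n q →
    (∃ λ S → IndependentIn P S × suc n ≤ count S) ⊎ 2 * q * count P ≤ degreeSumIn P + n * (q * suc q)
  turán P n q with minimumOn P (degreeIn P)
  ... | inj₁ empty = inj₂ (≤-trans (≤-reflexive (trans (cong (2 * q *_) (count-none empty)) (*-zeroʳ (2 * q)))) z≤n)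
  ... | inj₂ (v , Pv , min) = step n
    where
    open RemoveClosedNbhd P v Pv
    step : ∀ n → (∃ λ S → IndependentIn P S × suc n ≤ count S) ⊎ 2 * q * count P ≤ degreeSumIn P + n * (q * suc q)
    step zero = inj₁ (extend ((λ _ → false) , ((λ _ ()) , (λ _ _ ())) , z≤n))
    step (suc n) with turán P′ n q
    ... | inj₁ big   = inj₁ (extend big)
    ... | inj₂ bound = inj₂ (begin
      2 * q * count P                                     ≡⟨ cong (2 * q *_) count-P′ ⟩
      2 * q * (count P′ + suc d)                          ≡⟨ *-distribˡ-+ (2 * q) (count P′) (suc d) ⟩
      2 * q * count P′ + 2 * q * suc d                    ≤⟨ +-mono-≤ bound (2q[d+1]≤d[d+1]+q[q+1] d q) ⟩
      (degreeSumIn P′ + n * t) + (suc d * d + t)          ≡⟨ regroup (degreeSumIn P′) (n * t) (suc d * d) t ⟩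
      (degreeSumIn P′ + suc d * d) + (t + n * t)          ≤⟨ +-monoˡ-≤ (suc n * t) (degreeSumIn-P′ min) ⟩
      degreeSumIn P + suc n * t                           ∎)
      where
      open ≤-Reasoning
      d = degreeIn P v
      t = q * suc q
      regroup : ∀ a b c e → (a + b) + (c + e) ≡ (a + c) + (e + b)
      regroup = solve-∀

-- Unions of cliques

cliqueUnion : (r a q : ℕ) → Graph (r * suc q + a * q)
cliqueUnion r a q = copies r (K (suc q)) ∪G copies a (K q)

cover-cliqueUnion : ∀ r a q → CliqueCover (cliqueUnion r a q) (r + a)
cover-cliqueUnion r a q = cover-∪G (cover-copies (cover-K (suc q)) r) (cover-copies (cover-K q) a)

degreeSum-cliqueUnion : ∀ r a q → degreeSum (cliqueUnion r a q) + a * q ≡ q * ((r + a) * q + r)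
degreeSum-cliqueUnion r a q = +-cancelʳ-≡ (r * suc q) _ _ (begin
  degreeSum (cliqueUnion r a q) + a * q + r * suc q
    ≡⟨ cong (λ e → e + a * q + r * suc q) (trans (degreeSum-∪G (copies r (K (suc q))) (copies a (K q)))
                                                (cong₂ _+_ (degreeSum-copies r (K (suc q))) (degreeSum-copies a (K q)))) ⟩
  r * X + a * Y + a * q + r * suc q          ≡⟨ regroup r a q X Y ⟩
  r * (X + suc q) + a * (Y + q)              ≡⟨ cong₂ (λ u w → r * u + a * w) (degreeSum-K (suc q)) (degreeSum-K q) ⟩
  r * (suc q * suc q) + a * (q * q)          ≡⟨ expand r a q ⟩
  q * ((r + a) * q + r) + r * suc q          ∎)
  where
  open ≡-Reasoning
  X = degreeSum (K (suc q))
  Y = degreeSum (K q)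
  regroup : ∀ r a q X Y → r * X + a * Y + a * q + r * suc q ≡ r * (X + suc q) + a * (Y + q)
  regroup = solve-∀
  expand : ∀ r a q → r * (suc q * suc q) + a * (q * q) ≡ q * ((r + a) * q + r) + r * suc q
  expand = solve-∀

degreeSum-≅-cliqueUnion : ∀ {N} n q r {G : Graph N} → G ≅ cliqueUnion r (n ∸ r) q → N ≡ n * q + r → r < n →
  degreeSum G + (n ∸ r) * q ≡ q * N
degreeSum-≅-cliqueUnion {N} n q r {G} G≅ N≡nq+r r<n = begin
  degreeSum G + (n ∸ r) * q
    ≡⟨ cong (_+ (n ∸ r) * q) (degreeSum-≅ {G = G} {H = cliqueUnion r (n ∸ r) q} G≅) ⟩
  degreeSum (cliqueUnion r (n ∸ r) q) + (n ∸ r) * q ≡⟨ degreeSum-cliqueUnion r (n ∸ r) q ⟩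
  q * ((r + (n ∸ r)) * q + r)                       ≡⟨ cong (λ m → q * (m * q + r)) (m+[n∸m]≡n (<⇒≤ r<n)) ⟩
  q * (n * q + r)                                   ≡⟨ cong (q *_) N≡nq+r ⟨
  q * N                                             ∎
  where open ≡-Reasoning

n[1+q]≡N+[n∸r] : ∀ {N} n q r → N ≡ n * q + r → r < n → n * suc q ≡ N + (n ∸ r)
n[1+q]≡N+[n∸r] {N} n q r N≡nq+r r<n = begin
  n * suc q              ≡⟨ trans (*-suc n q) (+-comm n (n * q)) ⟩
  n * q + n              ≡⟨ cong (n * q +_) (m+[n∸m]≡n (<⇒≤ r<n)) ⟨
  n * q + (r + (n ∸ r))  ≡⟨ +-assoc (n * q) r (n ∸ r) ⟨
  n * q + r + (n ∸ r)    ≡⟨ cong (_+ (n ∸ r)) N≡nq+r ⟨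
  N + (n ∸ r)            ∎
  where open ≡-Reasoning

-- The lower bound

∣S∣≡count : ∀ {m} (S : Subset m) → ∣ S ∣ ≡ count (lookup S)
∣S∣≡count []          = refl
∣S∣≡count (true ∷ S)  = cong suc (∣S∣≡count S)
∣S∣≡count (false ∷ S) = ∣S∣≡count S

restrict : ∀ {m N k} → (Fin m → Fin N) → EdgeColoring N k → EdgeColoring m k
restrict e f = record { col = λ x y → col f (e x) (e y) ; colSym = λ x y → colSym f (e x) (e y) }

module FactorColoring {k N} {H : Fin k → Graph N} (i₀ : Fin k) (factor : FactorableInto (K N) H) where

  colour : Fin N → Fin N → Fin k
  -- The diagonal colour i₀ is irrelevant: colour classes are irreflexive.
  colour x y with x ≟ y
  ... | yes _   = i₀
  ... | no  x≢y = proj₁ (proj₂ factor x y (adj-K x≢y))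

  colour-unique : ∀ i x y → adj (H i) x y ≡ true → colour x y ≡ i
  colour-unique i x y Hxy with x ≟ y
  ... | yes refl = contradiction (trans (sym Hxy) (adjIrr (H i) x)) λ ()
  ... | no  x≢y  = sym (proj₂ (proj₂ (proj₂ factor x y (adj-K x≢y))) i Hxy)

  colour-sym : ∀ x y → colour x y ≡ colour y x
  colour-sym x y with x ≟ y | y ≟ x
  ... | yes _   | yes _   = refl
  ... | yes x≡y | no  y≢x = contradiction (sym x≡y) y≢x
  ... | no  x≢y | yes y≡x = contradiction (sym y≡x) x≢y
  ... | no  x≢y | no  y≢x = sym (proj₂ (proj₂ (proj₂ factor x y (adj-K x≢y))) _
                                 (trans (adjSym (H _) x y) (proj₁ (proj₂ (proj₂ factor y x (adj-K y≢x))))))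

  coloring : EdgeColoring N k
  coloring = record { col = colour ; colSym = colour-sym }

¬ComplRamseyProp-≤ : ∀ {k N n′} {H : Fin k → Graph N} {c : Fin k → ℕ} → Fin k → FactorableInto (K N) H →
  (∀ i → CliqueCover (H i) (c i)) → n′ ≤ N → ¬ ComplRamseyProp k (λ i → suc (c i)) n′
¬ComplRamseyProp-≤ {k} {N} {n′} {H} {c} i₀ factor cover n′≤N prop = no-large-class (prop f′)
  where
  open FactorColoring {H = H} i₀ factor
  e : Fin n′ → Fin N
  e x = inject≤ x n′≤N
  f′ : EdgeColoring n′ k
  f′ = restrict e coloring

  H∘e⊆class : ∀ i x y → adj (H i) (e x) (e y) ≡ true → adj (colorClass f′ i) x y ≡ true
  H∘e⊆class i x y Hxy with x ≟ y
  ... | yes refl = contradiction (trans (sym Hxy) (adjIrr (H i) (e x))) λ ()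
  ... | no  _    = dec-true (colour (e x) (e y) ≟ i) (colour-unique i (e x) (e y) Hxy)

  class-cover : ∀ i → CliqueCover (colorClass f′ i) (c i)
  class-cover i = cover-pullback e (λ {x} {y} → inject≤-injective n′≤N n′≤N x y) (H∘e⊆class i) (cover i)

  no-large-class : ¬ Σ (Fin k) λ i → IndepNumberAtLeast (colorClass f′ i) (suc (c i))
  no-large-class (i , S , S-indep , c<∣S∣) = n≮n (c i) (begin-strict
    c i              <⟨ c<∣S∣ ⟩
    ∣ S ∣            ≡⟨ ∣S∣≡count S ⟩
    count (lookup S) ≤⟨ independent-≤-cover (class-cover i)
                          (λ x y Sx Sy → S-indep x y (lookup⇒[]= x S Sx) (lookup⇒[]= y S Sy)) ⟩
    c i              ∎)
    where open ≤-Reasoning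

-- The upper bound

IndependentIn⇒IndepNumberAtLeast : ∀ {m c} {G : Graph m} →
  (∃ λ S → IndependentIn G (λ _ → true) S × c ≤ count S) → IndepNumberAtLeast G c
IndependentIn⇒IndepNumberAtLeast (S , (_ , S-indep) , c≤S) =
  tabulate S , (λ x y x∈ y∈ → S-indep x y (∈⇒true x∈) (∈⇒true y∈)) ,
  ≤-trans c≤S (≤-reflexive (sym (trans (∣S∣≡count (tabulate S)) (sum-cong-≗ (cong 𝟙 ∘ lookup∘tabulate S)))))
  where
  ∈⇒true : ∀ {x} → x ∈ tabulate S → S x ≡ true
  ∈⇒true {x} x∈ = trans (sym (lookup∘tabulate S x)) ([]=⇒lookup x∈)

∃-or-∀ : ∀ {k} {A B : Fin k → Set} → (∀ i → A i ⊎ B i) → ∃ A ⊎ (∀ i → B i)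
∃-or-∀ {zero}  _      = inj₂ λ ()
∃-or-∀ {suc k} A-or-B with A-or-B zero | ∃-or-∀ (A-or-B ∘ suc)
... | inj₁ A0 | _               = inj₁ (zero , A0)
... | inj₂ _  | inj₁ (i , Ai)   = inj₁ (suc i , Ai)
... | inj₂ B0 | inj₂ B-suc      = inj₂ λ { zero → B0 ; (suc i) → B-suc i }

colour-excess : ∀ N n q a E D → E + a * q ≡ q * N → n * suc q ≡ N + a →
  2 * q * suc N ≤ D + n * (q * suc q) → E + 2 * q ≤ D
colour-excess N n q a E D E+aq≡qN n[q+1]≡N+a bound =
  +-cancelʳ-≤ (q * (N + a)) (E + 2 * q) D (begin
    (E + 2 * q) + q * (N + a)   ≡⟨ regroup E a q N ⟩
    (E + a * q) + q * N + 2 * q ≡⟨ cong (λ e → e + q * N + 2 * q) E+aq≡qN ⟩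
    q * N + q * N + 2 * q       ≡⟨ double q N ⟩
    2 * q * suc N               ≤⟨ bound ⟩
    D + n * (q * suc q)         ≡⟨ cong (D +_) (trans (*-comm-middle n q) (cong (q *_) n[q+1]≡N+a)) ⟩
    D + q * (N + a)             ∎)
  where
  open ≤-Reasoning
  regroup : ∀ E a q N → (E + 2 * q) + q * (N + a) ≡ (E + a * q) + q * N + 2 * q
  regroup = solve-∀
  double : ∀ q N → q * N + q * N + 2 * q ≡ 2 * q * suc N
  double = solve-∀
  *-comm-middle : ∀ n q → n * (q * suc q) ≡ q * (n * suc q)
  *-comm-middle = solve-∀

degreeSums-contradiction : ∀ {N} SE SD Q A → 0 < N →
  SE + N ≡ N * N → SD + suc N ≡ suc N * suc N → SE + 2 * Q ≤ SD → SE + A ≡ Q * N → suc Q ≤ A → ⊥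
degreeSums-contradiction {suc n} SE SD Q A _ SE+N≡N² SD+N+1≡[N+1]² SE+2Q≤SD SE+A≡QN Q<A =
  n≮n SE (begin-strict
    SE     <⟨ +-cancelʳ-≤ Q (suc SE) (Q * n) SE+Q<Qn+Q ⟩
    Q * n  ≤⟨ *-monoˡ-≤ n Q≤N ⟩
    suc n * n ≡⟨ SE≡ ⟨
    SE     ∎)
  where
  open ≤-Reasoning
  SE≡ : SE ≡ suc n * n
  SE≡ = +-cancelʳ-≡ (suc n) _ _ (trans SE+N≡N² (square n))
    where
    square : ∀ n → suc n * suc n ≡ suc n * n + suc n
    square = solve-∀
  SD≡ : SD ≡ SE + 2 * suc n
  SD≡ = +-cancelʳ-≡ (suc (suc n)) _ _
    (trans SD+N+1≡[N+1]² (trans (square n) (cong (λ e → e + 2 * suc n + suc (suc n)) (sym SE≡))))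
    where
    square : ∀ n → suc (suc n) * suc (suc n) ≡ suc n * n + 2 * suc n + suc (suc n)
    square = solve-∀
  Q≤N : Q ≤ suc n
  Q≤N = *-cancelˡ-≤ 2 (+-cancelˡ-≤ SE (2 * Q) (2 * suc n) (≤-trans SE+2Q≤SD (≤-reflexive SD≡)))
  SE+Q<Qn+Q : suc SE + Q ≤ Q * n + Q
  SE+Q<Qn+Q = begin
    suc SE + Q  ≡⟨ +-suc SE Q ⟨
    SE + suc Q  ≤⟨ +-monoʳ-≤ SE Q<A ⟩
    SE + A      ≡⟨ SE+A≡QN ⟩
    Q * suc n   ≡⟨ trans (*-suc Q n) (+-comm Q (Q * n)) ⟩
    Q * n + Q   ∎

excess-sum : ∀ {k} (a q : Fin k → ℕ) → (∀ i → 0 < a i) → (∃ λ j → 0 < (a j ∸ 1) * q j) →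
  suc (sum q) ≤ sum (λ i → a i * q i)
excess-sum a q a>0 (j , 0<[aj-1]qj) = begin
  suc (sum q)                        ≡⟨ +-comm 1 (sum q) ⟩
  sum q + 1                          ≤⟨ +-monoʳ-≤ (sum q) (≤-trans 0<[aj-1]qj (≤-sum (λ i → (a i ∸ 1) * q i) j)) ⟩
  sum q + sum (λ i → (a i ∸ 1) * q i) ≡⟨ ∑-distrib-+ q (λ i → (a i ∸ 1) * q i) ⟨
  sum (λ i → q i + (a i ∸ 1) * q i)  ≡⟨ sum-cong-≗ (λ i → a*q≡q+[a-1]*q (a>0 i)) ⟨
  sum (λ i → a i * q i)              ∎
  where
  open ≤-Reasoning
  a*q≡q+[a-1]*q : ∀ {a q} → 0 < a → a * q ≡ q + (a ∸ 1) * q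
  a*q≡q+[a-1]*q {suc a} _ = refl

ComplRamseyProp-upper : ∀ {k N} (H : Fin k → Graph N) → FactorableInto (K N) H → (n q a : Fin k → ℕ) →
  (∀ i → degreeSum (H i) + a i * q i ≡ q i * N) → (∀ i → n i * suc (q i) ≡ N + a i) →
  suc (sum q) ≤ sum (λ i → a i * q i) → 0 < N → ComplRamseyProp k (λ i → suc (n i)) (suc N)
ComplRamseyProp-upper {k} {N} H factor n q a E+aq≡qN n[q+1]≡N+a Q<A N>0 f
  with ∃-or-∀ (λ i → turán (colorClass f i) (λ _ → true) (n i) (q i))
... | inj₁ (i , large) = i , IndependentIn⇒IndepNumberAtLeast {G = colorClass f i} large
... | inj₂ dense = ⊥-elim (degreeSums-contradiction
        (sum E) (sum (λ i → degreeSum (colorClass f i))) (sum q) (sum (λ i → a i * q i)) N>0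
        (degreeSum-partition H (factorable⇒partition {H = H} factor))
        (degreeSum-partition (colorClass f) (colorClass-partition f))
        SE+2Q≤SD SE+A≡QN Q<A)
  where
  E : Fin k → ℕ
  E i = degreeSum (H i)
  excess : ∀ i → E i + 2 * q i ≤ degreeSum (colorClass f i)
  excess i = colour-excess N (n i) (q i) (a i) (E i) (degreeSum (colorClass f i)) (E+aq≡qN i) (n[q+1]≡N+a i)
    (subst (λ M → 2 * q i * M ≤ degreeSum (colorClass f i) + n i * (q i * suc (q i))) (count-all (suc N)) (dense i))
  SE+2Q≤SD : sum E + 2 * sum q ≤ sum (λ i → degreeSum (colorClass f i))
  SE+2Q≤SD = ≤-trans (≤-reflexive (trans (cong (sum E +_) (*-distribˡ-sum 2 q)) (sym (∑-distrib-+ E (λ i → 2 * q i)))))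
                     (sum-mono-≤ excess)
  SE+A≡QN : sum E + sum (λ i → a i * q i) ≡ sum q * N
  SE+A≡QN = trans (sym (∑-distrib-+ E (λ i → a i * q i))) (trans (sum-cong-≗ E+aq≡qN) (sym (*-distribʳ-sum N q)))

theorem4p4 : (k N : ℕ) → 1 < N →
    (H : Fin k → Graph N) → FactorableInto (K N) H →
    (n q r : Fin k → ℕ) →
    (∀ i → H i ≅ (copies (r i) (K (suc (q i))) ∪G copies (n i ∸ r i) (K (q i)))) →
    (∀ i → N ≡ n i * q i + r i) →
    (∀ i → r i < n i) →
    Σ (Fin k) (λ i → 0 < (n i ∸ r i ∸ 1) * q i) →
    ComplRamseyIs k (λ i → suc (n i)) (suc N)
theorem4p4 k N 1<N H factor n q r H≅ N≡nq+r r<n excess@(j , _) =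
  s≤s z≤n , upper , λ n′ _ prop → ≰⇒> λ n′≤N → ¬ComplRamseyProp-≤ j factor cover n′≤N prop
  where
  a : Fin k → ℕ
  a i = n i ∸ r i

  cover : ∀ i → CliqueCover (H i) (n i)
  cover i = subst (CliqueCover (H i)) (m+[n∸m]≡n (<⇒≤ (r<n i)))
                  (cover-≅ (H≅ i) (cover-cliqueUnion (r i) (a i) (q i)))

  upper : ComplRamseyProp k (λ i → suc (n i)) (suc N)
  upper = ComplRamseyProp-upper H factor n q a
    (λ i → degreeSum-≅-cliqueUnion (n i) (q i) (r i) {H i} (H≅ i) (N≡nq+r i) (r<n i))
    (λ i → n[1+q]≡N+[n∸r] (n i) (q i) (r i) (N≡nq+r i) (r<n i))
    (excess-sum a q (λ i → m<n⇒0<n∸m (r<n i)) excess)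
    (<-trans z<s 1<N)
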